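{- Let $\widehat{G}$ be a minimum interval supergraph of a graph $G$. Every module $M$ of $G$ such that $G[M]$ is connected is a module of $\widehat{G}$, and if $\widehat{G}[M]$ is not a clique, then for every minimum interval supergraph $H$ of $G[M]$, replacing $\widehat{G}[M]$ by $H$ in $\widehat{G}$ gives a minimum interval supergraph of $G$.
   Context: Graphs are finite, simple, undirected. A module of $G$ is a set $M\subseteq V(G)$ such that every vertex outside $M$ is adjacent to all or none of $M$. An interval supergraph of $G$ is an interval graph on vertex set $V(G)$ whose edge set contains $E(G)$; it is minimum if it has the minimum number of edges among such. If $M$ is a module of a graph $\Gamma$ on $V(G)$ and $H$ is a graph on vertex set $M$, replacing $\Gamma[M]$ by $H$ in $\Gamma$ means taking the graph on $V(G)$ whose edges are the edges of $\Gamma$ not having both ends in $M$ together with the edges of $H$. -}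

module Defs where

open import Data.Nat using (ℕ; zero; suc; _≤_; _<ᵇ_)
open import Data.Bool using (Bool; true; false; _∧_; if_then_else_)
open import Data.Fin using (Fin; toℕ)
open import Data.List using (List; map; allFin)
open import Data.Nat.ListAction using (sum)
open import Data.Product using (Σ; _×_; _,_)
open import Data.Sum using (_⊎_)
open import Relation.Nullary using (¬_)
open import Relation.Binary.PropositionalEquality using (_≡_; refl)
open import Function.Bundles using (_⇔_)

record Graph (n : ℕ) : Set where
  field
    adj    : Fin n → Fin n → Bool
    sym    : ∀ u v → adj u v ≡ adj v u
    irrefl : ∀ u → adj u u ≡ false
open Graph public

VSet : ℕ → Set
VSet n = Fin n → Bool

_∈_ : ∀ {n} → Fin n → VSet n → Set
u ∈ S = S u ≡ true

_∉_ : ∀ {n} → Fin n → VSet n → Set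
u ∉ S = S u ≡ false

full : ∀ {n} → VSet n
full _ = true

edgeCount : ∀ {n} → Graph n → ℕ
edgeCount {n} G =
  sum (map (λ u → sum (map (λ v → if (toℕ u <ᵇ toℕ v) ∧ adj G u v then 1 else 0)
                           (allFin n)))
           (allFin n))

-- A graph (on Fin n) "is a graph on vertex set S": all edges lie inside S.
-- Graphs on a vertex set S ⊆ Fin n are represented this way.
OnVertexSet : ∀ {n} → VSet n → Graph n → Set
OnVertexSet S H = ∀ u v → adj H u v ≡ true → u ∈ S

induced : ∀ {n} → Graph n → VSet n → Graph n
induced {n} G M = record { adj = a ; sym = s ; irrefl = i }
  where
  a : Fin n → Fin n → Bool
  a u v = M u ∧ M v ∧ adj G u v
  s : ∀ u v → a u v ≡ a v u
  s u v with M u | M v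
  ... | true  | true  = Graph.sym G u v
  ... | true  | false = refl
  ... | false | true  = refl
  ... | false | false = refl
  i : ∀ u → a u u ≡ false
  i u with M u
  ... | true  = Graph.irrefl G u
  ... | false = refl

IsIntervalOn : ∀ {n} → VSet n → Graph n → Set
IsIntervalOn {n} S H =
  OnVertexSet S H ×
  Σ (Fin n → ℕ) λ l → Σ (Fin n → ℕ) λ r →
    (∀ v → v ∈ S → l v ≤ r v) ×
    (∀ u v → u ∈ S → v ∈ S → ¬ (u ≡ v) →
       (adj H u v ≡ true) ⇔ (l u ≤ r v × l v ≤ r u))

SubgraphOf : ∀ {n} → Graph n → Graph n → Set
SubgraphOf G H = ∀ u v → adj G u v ≡ true → adj H u v ≡ true

IsIntervalSupergraphOn : ∀ {n} → VSet n → Graph n → Graph n → Set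
IsIntervalSupergraphOn S G H = IsIntervalOn S H × SubgraphOf G H

IsMinIntervalSupergraphOn : ∀ {n} → VSet n → Graph n → Graph n → Set
IsMinIntervalSupergraphOn S G H =
  IsIntervalSupergraphOn S G H ×
  (∀ H′ → IsIntervalSupergraphOn S G H′ → edgeCount H ≤ edgeCount H′)

IsModule : ∀ {n} → Graph n → VSet n → Set
IsModule G M =
  ∀ x → x ∉ M →
    (∀ u → u ∈ M → adj G x u ≡ true) ⊎ (∀ u → u ∈ M → adj G x u ≡ false)

IsClique : ∀ {n} → Graph n → VSet n → Set
IsClique G M = ∀ u v → u ∈ M → v ∈ M → ¬ (u ≡ v) → adj G u v ≡ true

data ReachIn {n} (G : Graph n) (M : VSet n) : Fin n → Fin n → Set where
  here : ∀ {u} → u ∈ M → ReachIn G M u u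
  step : ∀ {u w v} → ReachIn G M u w → v ∈ M → adj G w v ≡ true → ReachIn G M u v

ConnectedIn : ∀ {n} → Graph n → VSet n → Set
ConnectedIn G M = ∀ u v → u ∈ M → v ∈ M → ReachIn G M u v

replace : ∀ {n} → Graph n → VSet n → Graph n → Graph n
replace {n} Γ M H = record { adj = a ; sym = s ; irrefl = i }
  where
  a : Fin n → Fin n → Bool
  a u v = if M u ∧ M v then adj H u v else adj Γ u v
  s : ∀ u v → a u v ≡ a v u
  s u v with M u | M v
  ... | true  | true  = Graph.sym H u v
  ... | true  | false = Graph.sym Γ u v
  ... | false | true  = Graph.sym Γ u v
  ... | false | false = Graph.sym Γ u v
  i : ∀ u → a u u ≡ false
  i u with M u
  ... | true  = Graph.irrefl H u
  ... | false = Graph.irrefl Γ u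

module Submission where

-- Fix an interval model [lo v, hi v] of Ĝ and let α be the least right end and β the greatest
-- left end of the intervals of M; every G-neighbour of M outside M reaches from ≤ α to ≥ β.
-- If β ≤ α, squeezing all intervals of M to [β, α] gives an interval supergraph of G that differs
-- from Ĝ only by losing edges between M and its complement, so by minimality it loses none, and an
-- outside vertex meets [β, α] exactly when it meets all of M.  If α < β, pick the gap (p, p + 1),
-- α ≤ p < β, straddled by the fewest outside intervals, cut the line there and place a copy of the
-- intervals of M in the cut: each v ∈ M then sees exactly the straddlers, at most as many outside
-- neighbours as before.  Minimality forces equality, so the outside neighbourhood of v is the set
-- of straddlers of every gap it covers; G-adjacent vertices of M cover a common gap and G[M] is
-- connected, so all of M has the same outside neighbourhood.  Once M is a module of Ĝ and Ĝ[M] is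
-- not a clique, the outside neighbours of M are exactly the straddlers of (α, α + 1); cutting there
-- and inserting a model of H models the replaced graph, whose edges with an end outside M are
-- those of Ĝ and whose edges inside M are no more than those of Ĝ[M].

open import Data.Bool using (Bool; true; false; not; _∧_; if_then_else_)
import Data.Bool as Bool
open import Data.Bool.Properties using (⇔→≡; T-≡; ¬-not; ∧-zeroʳ; not-injective)
open import Data.Fin using (Fin; toℕ; _≟_)
open import Data.Fin.Properties using (toℕ-injective; any?)
open import Data.List using (List; map; allFin; tabulate; filter; applyUpTo)
open import Data.List.Extrema.Nat
  using (argmin; argmax; argmin-all; argmax-all; f[argmin]≤f[xs]; f[xs]≤f[argmax])
open import Data.List.Membership.Propositional using () renaming (_∈_ to _∈ˡ_)
open import Data.List.Membership.Propositional.Properties using (∈-filter⁺; ∈-allFin; ∈-applyUpTo⁺)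
open import Data.List.Properties using (map-tabulate)
open import Data.List.Relation.Unary.All as All using (All)
open import Data.List.Relation.Unary.All.Properties using (all-filter; applyUpTo⁺₁)
open import Data.Nat using (ℕ; zero; suc; pred; _+_; _*_; _∸_; _⊔_; _⊓_; _≤_; _<_; _<ᵇ_; z≤n; s≤s; _≤?_)
import Data.Nat.ListAction as List
open import Data.Nat.Properties hiding (_≟_)
open import Algebra.Properties.CommutativeMonoid.Sum +-0-commutativeMonoid
  using (sum; sum-syntax; sum-cong-≗; ∑-distrib-+; ∑-comm)
open import Data.Product using (∃-syntax; _×_; _,_; proj₁; proj₂; swap)
open import Data.Product.Function.NonDependent.Propositional using (_×-⇔_)
open import Data.Sum using (inj₁; inj₂)
open import Function using (_∘_; id)
open import Function.Bundles using (_⇔_; mk⇔; Equivalence)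
open import Function.Properties.Equivalence using () renaming (refl to ⇔-refl; trans to ⇔-trans; sym to ⇔-sym)
open import Relation.Binary.Definitions using (tri<; tri≈; tri>)
open import Relation.Binary.PropositionalEquality
open import Relation.Nullary using (¬_; Dec; yes; no; does; contradiction; ¬?)
open import Relation.Nullary.Decidable using (_×-dec_; dec-true; dec-false; does-⇔)

open import Defs renaming (sym to adj-sym)

𝟙 : Bool → ℕ
𝟙 b = if b then 1 else 0

𝟙-mono : ∀ {a b} → (a ≡ true → b ≡ true) → 𝟙 a ≤ 𝟙 b
𝟙-mono {false} a⇒b = z≤n
𝟙-mono {true} a⇒b rewrite a⇒b refl = ≤-refl

≡-true⇔ : ∀ {a b : Bool} → a ≡ b → a ≡ true ⇔ b ≡ true
≡-true⇔ a≡b = mk⇔ (trans (sym a≡b)) (trans a≡b)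

does⇒ : ∀ {a} {A : Set a} (A? : Dec A) → does A? ≡ true → A
does⇒ (yes a) _ = a

_⊆_ : ∀ {n} → VSet n → VSet n → Set
S ⊆ T = ∀ i → i ∈ S → i ∈ T

∉⇒¬∈ : ∀ {n} {S : VSet n} {u} → u ∉ S → ¬ u ∈ S
∉⇒¬∈ u∉S u∈S = contradiction (trans (sym u∈S) u∉S) λ ()

∈∉⇒≢ : ∀ {n} {S : VSet n} {u v} → u ∈ S → v ∉ S → u ≢ v
∈∉⇒≢ {S = S} u∈S v∉S refl = ∉⇒¬∈ {S = S} v∉S u∈S

-- Finite sums and counting

sum-allFin : ∀ {n} (f : Fin n → ℕ) → List.sum (map f (allFin n)) ≡ ∑[ i < n ] f i
sum-allFin {n} f = trans (cong List.sum (map-tabulate id f)) (sum-tabulate f)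
  where
  sum-tabulate : ∀ {m} (g : Fin m → ℕ) → List.sum (tabulate g) ≡ sum g
  sum-tabulate {zero} g = refl
  sum-tabulate {suc m} g = cong (g Fin.zero +_) (sum-tabulate (g ∘ Fin.suc))

∑-mono-≤ : ∀ {n} {f g : Fin n → ℕ} → (∀ i → f i ≤ g i) → sum f ≤ sum g
∑-mono-≤ {zero} f≤g = z≤n
∑-mono-≤ {suc n} f≤g = +-mono-≤ (f≤g Fin.zero) (∑-mono-≤ (f≤g ∘ Fin.suc))

∑-mono-< : ∀ {n} {f g : Fin n → ℕ} → (∀ i → f i ≤ g i) → ∀ i → f i < g i → sum f < sum g
∑-mono-< {suc n} f≤g Fin.zero fi<gi = +-mono-<-≤ fi<gi (∑-mono-≤ (f≤g ∘ Fin.suc))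
∑-mono-< {suc n} f≤g (Fin.suc i) fi<gi = +-mono-≤-< (f≤g Fin.zero) (∑-mono-< (f≤g ∘ Fin.suc) i fi<gi)

f[i]≤∑f : ∀ {n} (f : Fin n → ℕ) i → f i ≤ sum f
f[i]≤∑f f Fin.zero = m≤m+n _ _
f[i]≤∑f f (Fin.suc i) = ≤-trans (f[i]≤∑f (f ∘ Fin.suc) i) (m≤n+m _ _)

count : ∀ {n} → VSet n → ℕ
count {n} S = ∑[ i < n ] 𝟙 (S i)

count-mono : ∀ {n} {S T : VSet n} → S ⊆ T → count S ≤ count T
count-mono S⊆T = ∑-mono-≤ (λ i → 𝟙-mono (S⊆T i))

count-strict : ∀ {n} {S T : VSet n} → S ⊆ T → ∀ i → i ∉ S → i ∈ T → count S < count T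
count-strict S⊆T i i∉S i∈T =
  ∑-mono-< (λ j → 𝟙-mono (S⊆T j)) i (subst₂ (λ a b → 𝟙 a < 𝟙 b) (sym i∉S) (sym i∈T) ≤-refl)

count-cong : ∀ {n} {S T : VSet n} → (∀ i → S i ≡ T i) → count S ≡ count T
count-cong S≗T = sum-cong-≗ (λ i → cong 𝟙 (S≗T i))

⊆∧count≥⇒⊇ : ∀ {n} {S T : VSet n} → S ⊆ T → count T ≤ count S → T ⊆ S
⊆∧count≥⇒⊇ {S = S} S⊆T T≤S i i∈T with S i in e
... | true = refl
... | false = contradiction T≤S (<⇒≱ (count-strict S⊆T i e i∈T))

∑² : ∀ {n} → (Fin n → Fin n → ℕ) → ℕ
∑² {n} f = ∑[ u < n ] ∑[ v < n ] f u v

∑²-cong : ∀ {n} {f g : Fin n → Fin n → ℕ} → (∀ u v → f u v ≡ g u v) → ∑² f ≡ ∑² g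
∑²-cong f≡g = sum-cong-≗ (λ u → sum-cong-≗ (f≡g u))

∑²-distrib-+ : ∀ {n} (f g : Fin n → Fin n → ℕ) → ∑² (λ u v → f u v + g u v) ≡ ∑² f + ∑² g
∑²-distrib-+ {n} f g =
  trans (sum-cong-≗ (λ u → ∑-distrib-+ (f u) (g u))) (∑-distrib-+ (λ u → sum (f u)) (λ u → sum (g u)))

argmin-on : ∀ {a} {A : Set a} (f : A → ℕ) {P : A → Set} (xs : List A) {d : A} →
  P d → All P xs → (∀ {x} → P x → x ∈ˡ xs) → ∃[ m ] P m × (∀ {x} → P x → f m ≤ f x)
argmin-on f xs {d} Pd Pxs complete =
  argmin f d xs , argmin-all f Pd Pxs , λ Px → All.lookup (f[argmin]≤f[xs] d xs) (complete Px)

argmax-on : ∀ {a} {A : Set a} (f : A → ℕ) {P : A → Set} (xs : List A) {d : A} →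
  P d → All P xs → (∀ {x} → P x → x ∈ˡ xs) → ∃[ m ] P m × (∀ {x} → P x → f x ≤ f m)
argmax-on f xs {d} Pd Pxs complete =
  argmax f d xs , argmax-all f Pd Pxs , λ Px → All.lookup (f[xs]≤f[argmax] d xs) (complete Px)

members : ∀ {n} → VSet n → List (Fin n)
members {n} S = filter (λ v → S v Bool.≟ true) (allFin n)

all-members : ∀ {n} (S : VSet n) → All (_∈ S) (members S)
all-members {n} S = all-filter (λ v → S v Bool.≟ true) (allFin n)

members-complete : ∀ {n} (S : VSet n) {v} → v ∈ S → v ∈ˡ members S
members-complete S v∈S = ∈-filter⁺ (λ v → S v Bool.≟ true) (∈-allFin _) v∈S

minimiser : ∀ {n} (f : Fin n → ℕ) (S : VSet n) {u} → u ∈ S → ∃[ m ] m ∈ S × (∀ {v} → v ∈ S → f m ≤ f v)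
minimiser f S u∈S = argmin-on f (members S) u∈S (all-members S) (members-complete S)

maximiser : ∀ {n} (f : Fin n → ℕ) (S : VSet n) {u} → u ∈ S → ∃[ m ] m ∈ S × (∀ {v} → v ∈ S → f v ≤ f m)
maximiser f S u∈S = argmax-on f (members S) u∈S (all-members S) (members-complete S)

minimiser-between : (g : ℕ → ℕ) {α β : ℕ} → α < β →
  ∃[ p ] (α ≤ p × p < β) × (∀ {q} → α ≤ q × q < β → g p ≤ g q)
minimiser-between g {α} {β} α<β =
  argmin-on g (applyUpTo (α +_) (β ∸ α)) (≤-refl , α<β) (applyUpTo⁺₁ (α +_) (β ∸ α) in-range) listed
  where
  in-range : ∀ {i} → i < β ∸ α → α ≤ α + i × α + i < β
  in-range {i} i<β∸α = m≤m+n α i , subst (α + i <_) (m+[n∸m]≡n (<⇒≤ α<β)) (+-monoʳ-< α i<β∸α)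
  listed : ∀ {q} → α ≤ q × q < β → q ∈ˡ applyUpTo (α +_) (β ∸ α)
  listed (α≤q , q<β) = subst (_∈ˡ _) (m+[n∸m]≡n α≤q) (∈-applyUpTo⁺ (α +_) (∸-monoˡ-< q<β α≤q))

-- Edge counts

adj⇒≢ : ∀ {n} (G : Graph n) {u v} → adj G u v ≡ true → u ≢ v
adj⇒≢ G {u} e refl = contradiction (trans (sym e) (irrefl G u)) λ ()

<ᵇ-true : ∀ {m n} → m < n → (m <ᵇ n) ≡ true
<ᵇ-true m<n = Equivalence.to T-≡ (<⇒<ᵇ m<n)

<ᵇ-false : ∀ {m n} → ¬ m < n → (m <ᵇ n) ≡ false
<ᵇ-false m≮n = ¬-not (λ e → m≮n (<ᵇ⇒< _ _ (Equivalence.from T-≡ e)))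

Before : ∀ {n} → Fin n → Fin n → Bool
Before u v = toℕ u <ᵇ toℕ v

edgeCount≡∑² : ∀ {n} (G : Graph n) → edgeCount G ≡ ∑² (λ u v → 𝟙 (Before u v ∧ adj G u v))
edgeCount≡∑² {n} G =
  trans (sum-allFin (λ u → List.sum (map (λ v → 𝟙 (Before u v ∧ adj G u v)) (allFin n))))
        (sum-cong-≗ (λ u → sum-allFin (λ v → 𝟙 (Before u v ∧ adj G u v))))

degreeSum : ∀ {n} → Graph n → ℕ
degreeSum G = ∑² (λ u v → 𝟙 (adj G u v))

handshake : ∀ {n} (G : Graph n) → degreeSum G ≡ 2 * edgeCount G
handshake G = begin
  degreeSum G                 ≡⟨ ∑²-cong ordered-split ⟩
  ∑² (λ u v → E u v + E v u)  ≡⟨ ∑²-distrib-+ E (λ u v → E v u) ⟩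
  ∑² E + ∑² (λ u v → E v u)   ≡⟨ cong (∑² E +_) (sym (∑-comm E)) ⟩
  ∑² E + ∑² E                 ≡⟨ cong (∑² E +_) (sym (+-identityʳ (∑² E))) ⟩
  2 * ∑² E                    ≡⟨ cong (2 *_) (sym (edgeCount≡∑² G)) ⟩
  2 * edgeCount G             ∎
  where
  open ≡-Reasoning
  E : _ → _ → ℕ
  E u v = 𝟙 (Before u v ∧ adj G u v)
  ordered-split : ∀ u v → 𝟙 (adj G u v) ≡ E u v + E v u
  ordered-split u v rewrite adj-sym G v u with adj G u v in e | <-cmp (toℕ u) (toℕ v)
  ... | false | _ rewrite ∧-zeroʳ (Before u v) | ∧-zeroʳ (Before v u) = refl
  ... | true | tri< u<v _ v≮u rewrite <ᵇ-true u<v | <ᵇ-false v≮u = refl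
  ... | true | tri> u≮v _ v<u rewrite <ᵇ-false u≮v | <ᵇ-true v<u = refl
  ... | true | tri≈ _ u≡v _ = contradiction (toℕ-injective u≡v) (adj⇒≢ G e)

edgeCount-≤ : ∀ {n} {G H : Graph n} → degreeSum G ≤ degreeSum H → edgeCount G ≤ edgeCount H
edgeCount-≤ {G = G} {H} le = *-cancelˡ-≤ 2 (subst₂ _≤_ (handshake G) (handshake H) le)

edgeCount-< : ∀ {n} {G H : Graph n} → degreeSum G < degreeSum H → edgeCount G < edgeCount H
edgeCount-< {G = G} {H} lt = *-cancelˡ-< 2 _ _ (subst₂ _<_ (handshake G) (handshake H) lt)

degreeSum-≤ : ∀ {n} {G H : Graph n} → edgeCount G ≤ edgeCount H → degreeSum G ≤ degreeSum H
degreeSum-≤ {G = G} {H} le = subst₂ _≤_ (sym (handshake G)) (sym (handshake H)) (*-monoʳ-≤ 2 le)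

degreeSum-cong : ∀ {n} {G H : Graph n} → (∀ u v → adj G u v ≡ adj H u v) → degreeSum G ≡ degreeSum H
degreeSum-cong G≗H = ∑²-cong (λ u v → cong 𝟙 (G≗H u v))

edgeCount-cong : ∀ {n} {G H : Graph n} → (∀ u v → adj G u v ≡ adj H u v) → edgeCount G ≡ edgeCount H
edgeCount-cong {G = G} {H} G≗H =
  *-cancelˡ-≡ (edgeCount G) (edgeCount H) 2
    (trans (sym (handshake G)) (trans (degreeSum-cong {G = G} {H} G≗H) (handshake H)))

crossing : ∀ {n} → Graph n → VSet n → ℕ
crossing G M = ∑² (λ u v → 𝟙 (M u ∧ not (M v) ∧ adj G u v))

outNbrs : ∀ {n} → Graph n → VSet n → Fin n → VSet n
outNbrs G M u v = not (M v) ∧ adj G u v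

outNbrs-∉ : ∀ {n} (G : Graph n) (M : VSet n) {u x} → x ∉ M → outNbrs G M u x ≡ adj G u x
outNbrs-∉ G M x∉M rewrite x∉M = refl

outNbrs-⊆ : ∀ {n} {G H : Graph n} (M : VSet n) {u} →
  (∀ {x} → x ∉ M → adj G u x ≡ true → adj H u x ≡ true) → outNbrs G M u ⊆ outNbrs H M u
outNbrs-⊆ M sub x e with M x in ex
... | false = sub ex e

crossing-< : ∀ {n} {G H : Graph n} (M : VSet n) →
  (∀ u → u ∈ M → count (outNbrs G M u) ≤ count (outNbrs H M u)) →
  ∀ u → u ∈ M → count (outNbrs G M u) < count (outNbrs H M u) → crossing G M < crossing H M
crossing-< {G = G} {H} M rows≤ u u∈M row< =
  ∑-mono-< rows≤′ u (subst (λ b → row G b u < row H b u) (sym u∈M) row<)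
  where
  row : Graph _ → Bool → Fin _ → ℕ
  row Γ b u = count (λ v → b ∧ outNbrs Γ M u v)
  rows≤′ : ∀ u → row G (M u) u ≤ row H (M u) u
  rows≤′ u with M u in u∈M
  ... | true  = rows≤ u u∈M
  ... | false = ≤-refl

degreeSum-split : ∀ {n} (G : Graph n) (M : VSet n) →
  degreeSum G ≡ degreeSum (induced G M) + degreeSum (induced G (not ∘ M)) + 2 * crossing G M
degreeSum-split G M = begin
  degreeSum G
    ≡⟨ ∑²-cong (λ u v → 𝟙-by-sides (M u) (M v) (adj G u v)) ⟩
  ∑² (λ u v → (I u v + O u v) + (C u v + C′ u v))
    ≡⟨ ∑²-distrib-+ (λ u v → I u v + O u v) (λ u v → C u v + C′ u v) ⟩
  ∑² (λ u v → I u v + O u v) + ∑² (λ u v → C u v + C′ u v)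
    ≡⟨ cong₂ _+_ (∑²-distrib-+ I O) (∑²-distrib-+ C C′) ⟩
  ∑² I + ∑² O + (∑² C + ∑² C′)
    ≡⟨ cong (λ z → ∑² I + ∑² O + (∑² C + z)) (trans C′≡C (sym (+-identityʳ _))) ⟩
  ∑² I + ∑² O + 2 * ∑² C
    ∎
  where
  open ≡-Reasoning
  I O C C′ : _ → _ → ℕ
  I u v = 𝟙 (M u ∧ M v ∧ adj G u v)
  O u v = 𝟙 (not (M u) ∧ not (M v) ∧ adj G u v)
  C u v = 𝟙 (M u ∧ not (M v) ∧ adj G u v)
  C′ u v = 𝟙 (not (M u) ∧ M v ∧ adj G u v)
  𝟙-by-sides : ∀ a b c →
    𝟙 c ≡ 𝟙 (a ∧ b ∧ c) + 𝟙 (not a ∧ not b ∧ c) + (𝟙 (a ∧ not b ∧ c) + 𝟙 (not a ∧ b ∧ c))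
  𝟙-by-sides true  true  true  = refl
  𝟙-by-sides true  true  false = refl
  𝟙-by-sides true  false true  = refl
  𝟙-by-sides true  false false = refl
  𝟙-by-sides false true  true  = refl
  𝟙-by-sides false true  false = refl
  𝟙-by-sides false false true  = refl
  𝟙-by-sides false false false = refl
  C′≡C : ∑² C′ ≡ ∑² C
  C′≡C = trans (∑-comm C′) (∑²-cong transposed)
    where
    transposed : ∀ u v → C′ v u ≡ C u v
    transposed u v rewrite adj-sym G v u with M u | M v
    ... | true  | true  = refl
    ... | true  | false = refl
    ... | false | true  = refl
    ... | false | false = refl

degreeSum-induced-cong : ∀ {n} {G H : Graph n} (S : VSet n) →
  (∀ u v → u ∈ S → v ∈ S → adj G u v ≡ adj H u v) → degreeSum (induced G S) ≡ degreeSum (induced H S)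
degreeSum-induced-cong {G = G} {H} S G≗H = degreeSum-cong {G = induced G S} {induced H S} induced≗
  where
  induced≗ : ∀ u v → adj (induced G S) u v ≡ adj (induced H S) u v
  induced≗ u v with S u in eu | S v in ev
  ... | true  | true  = G≗H u v eu ev
  ... | true  | false = refl
  ... | false | _     = refl

crossing-cong : ∀ {n} {G H : Graph n} (M : VSet n) →
  (∀ u v → u ∈ M → v ∉ M → adj G u v ≡ adj H u v) → crossing G M ≡ crossing H M
crossing-cong {G = G} {H} M G≗H = ∑²-cong cross≗
  where
  cross≗ : ∀ u v → 𝟙 (M u ∧ not (M v) ∧ adj G u v) ≡ 𝟙 (M u ∧ not (M v) ∧ adj H u v)
  cross≗ u v with M u in eu | M v in ev
  ... | true  | false = cong 𝟙 (G≗H u v eu ev)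
  ... | true  | true  = refl
  ... | false | _     = refl

edgeCount-<-of-crossing : ∀ {n} {G H : Graph n} (M : VSet n) →
  (∀ u v → M u ≡ M v → adj G u v ≡ adj H u v) → crossing G M < crossing H M → edgeCount G < edgeCount H
edgeCount-<-of-crossing {G = G} {H} M same-side fewer = edgeCount-< {G = G} {H} (begin-strict
  degreeSum G                     ≡⟨ degreeSum-split G M ⟩
  d G M + d G M̅ + 2 * crossing G M  <⟨ +-monoʳ-< (d G M + d G M̅) (*-monoʳ-< 2 fewer) ⟩
  d G M + d G M̅ + 2 * crossing H M  ≡⟨ cong₂ (λ a b → a + b + 2 * crossing H M)
                                             (degreeSum-induced-cong {G = G} {H} M inside)
                                             (degreeSum-induced-cong {G = G} {H} M̅ outside) ⟩
  d H M + d H M̅ + 2 * crossing H M  ≡⟨ sym (degreeSum-split H M) ⟩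
  degreeSum H                     ∎)
  where
  open ≤-Reasoning
  M̅ = not ∘ M
  d : Graph _ → VSet _ → ℕ
  d Γ S = degreeSum (induced Γ S)
  inside : ∀ u v → u ∈ M → v ∈ M → adj G u v ≡ adj H u v
  inside u v u∈M v∈M = same-side u v (trans u∈M (sym v∈M))
  outside : ∀ u v → u ∈ M̅ → v ∈ M̅ → adj G u v ≡ adj H u v
  outside u v u∉M v∉M = same-side u v (not-injective (trans u∉M (sym v∉M)))

edgeCount-≤-of-inside : ∀ {n} {G H : Graph n} (M : VSet n) →
  (∀ u v → ¬ (u ∈ M × v ∈ M) → adj G u v ≡ adj H u v) →
  edgeCount (induced G M) ≤ edgeCount (induced H M) → edgeCount G ≤ edgeCount H
edgeCount-≤-of-inside {G = G} {H} M agree fewer = edgeCount-≤ {G = G} {H} (begin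
  degreeSum G                     ≡⟨ degreeSum-split G M ⟩
  d G M + d G M̅ + 2 * crossing G M  ≤⟨ +-monoˡ-≤ (2 * crossing G M)
                                       (+-monoˡ-≤ (d G M̅) (degreeSum-≤ {G = induced G M} {induced H M} fewer)) ⟩
  d H M + d G M̅ + 2 * crossing G M  ≡⟨ cong₂ (λ a b → d H M + a + 2 * b)
                                             (degreeSum-induced-cong {G = G} {H} M̅ outside)
                                             (crossing-cong {G = G} {H} M across) ⟩
  d H M + d H M̅ + 2 * crossing H M  ≡⟨ sym (degreeSum-split H M) ⟩
  degreeSum H                     ∎)
  where
  open ≤-Reasoning
  M̅ = not ∘ M
  d : Graph _ → VSet _ → ℕ
  d Γ S = degreeSum (induced Γ S)
  outside : ∀ u v → u ∈ M̅ → v ∈ M̅ → adj G u v ≡ adj H u v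
  outside u v u∉M _ = agree u v (λ (u∈M , _) → contradiction (trans (sym u∈M) (not-injective u∉M)) λ ())
  across : ∀ u v → u ∈ M → v ∉ M → adj G u v ≡ adj H u v
  across u v _ v∉M = agree u v (λ (_ , v∈M) → ∉⇒¬∈ {S = M} v∉M v∈M)

-- Interval models

Meets : ∀ {n} → (Fin n → ℕ) → (Fin n → ℕ) → Fin n → Fin n → Set
Meets lo hi u v = lo u ≤ hi v × lo v ≤ hi u

Straddles : ∀ {n} → (Fin n → ℕ) → (Fin n → ℕ) → ℕ → Fin n → Set
Straddles lo hi p x = lo x ≤ p × suc p ≤ hi x

record IntervalModel {n} (Γ : Graph n) : Set where
  field
    lo hi     : Fin n → ℕ
    lo≤hi     : ∀ v → lo v ≤ hi v
    adj⇔meets : ∀ {u v} → u ≢ v → adj Γ u v ≡ true ⇔ Meets lo hi u v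

  adj⇒meets : ∀ {u v} → adj Γ u v ≡ true → Meets lo hi u v
  adj⇒meets e = Equivalence.to (adj⇔meets (adj⇒≢ Γ e)) e

  meets⇒adj : ∀ {u v} → u ≢ v → Meets lo hi u v → adj Γ u v ≡ true
  meets⇒adj u≢v = Equivalence.from (adj⇔meets u≢v)

isInterval⇒model : ∀ {n} {Γ : Graph n} → IsIntervalOn full Γ → IntervalModel Γ
isInterval⇒model (_ , lo , hi , lo≤hi , adj⇔) = record
  { lo = lo ; hi = hi ; lo≤hi = λ v → lo≤hi v refl ; adj⇔meets = λ {u} {v} → adj⇔ u v refl refl }

model⇒isInterval : ∀ {n} {Γ : Graph n} → IntervalModel Γ → IsIntervalOn full Γ
model⇒isInterval I = (λ _ _ _ → refl) , lo , hi , (λ v _ → lo≤hi v) , λ u v _ _ → adj⇔meets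
  where open IntervalModel I

adj-cong-models : ∀ {n} {Γ Γ′ : Graph n} (I : IntervalModel Γ) (I′ : IntervalModel Γ′) u v →
  let open IntervalModel in
  (u ≢ v → Meets (lo I) (hi I) u v ⇔ Meets (lo I′) (hi I′) u v) → adj Γ u v ≡ adj Γ′ u v
adj-cong-models {Γ = Γ} {Γ′} I I′ u v meets⇔ with u ≟ v
... | yes refl = trans (irrefl Γ u) (sym (irrefl Γ′ u))
... | no u≢v = ⇔→≡ (⇔-trans (IntervalModel.adj⇔meets I u≢v)
                   (⇔-trans (meets⇔ u≢v) (⇔-sym (IntervalModel.adj⇔meets I′ u≢v))))

interval-edge? : ∀ {n} (lo hi : Fin n → ℕ) u v → Dec (u ≢ v × Meets lo hi u v)
interval-edge? lo hi u v = ¬? (u ≟ v) ×-dec (lo u ≤? hi v ×-dec lo v ≤? hi u)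

intervalGraph : ∀ {n} → (Fin n → ℕ) → (Fin n → ℕ) → Graph n
intervalGraph {n} lo hi = record { adj = λ u v → does (edge? u v) ; sym = edge-sym ; irrefl = edge-irrefl }
  where
  edge? = interval-edge? lo hi
  edge-sym : ∀ u v → does (edge? u v) ≡ does (edge? v u)
  edge-sym u v = does-⇔ (mk⇔ flip flip) (edge? u v) (edge? v u)
    where
    flip : ∀ {u v} → u ≢ v × Meets lo hi u v → v ≢ u × Meets lo hi v u
    flip (u≢v , a , b) = u≢v ∘ sym , b , a
  edge-irrefl : ∀ u → does (edge? u u) ≡ false
  edge-irrefl u = dec-false (edge? u u) (λ (u≢u , _) → u≢u refl)

intervalGraph-model : ∀ {n} (lo hi : Fin n → ℕ) → (∀ v → lo v ≤ hi v) → IntervalModel (intervalGraph lo hi)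
intervalGraph-model lo hi lo≤hi = record
  { lo = lo ; hi = hi ; lo≤hi = lo≤hi
  ; adj⇔meets = λ {u} {v} u≢v →
      mk⇔ (λ e → proj₂ (does⇒ (edge? u v) e)) (λ m → dec-true (edge? u v) (u≢v , m)) }
  where
  edge? = interval-edge? lo hi

induced-interval : ∀ {n} {Γ : Graph n} (I : IntervalModel Γ) (S : VSet n) → IsIntervalOn S (induced Γ S)
induced-interval {Γ = Γ} I S = on-S , lo , hi , (λ v _ → lo≤hi v) , λ u v u∈S v∈S u≢v → adj⇔ u∈S v∈S u≢v
  where
  open IntervalModel I
  on-S : OnVertexSet S (induced Γ S)
  on-S u v e with S u in eu
  ... | true = refl
  adj⇔ : ∀ {u v} → u ∈ S → v ∈ S → u ≢ v → adj (induced Γ S) u v ≡ true ⇔ Meets lo hi u v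
  adj⇔ u∈S v∈S u≢v rewrite u∈S | v∈S = adj⇔meets u≢v

induced-mono : ∀ {n} {G Γ : Graph n} (S : VSet n) → SubgraphOf G Γ → SubgraphOf (induced G S) (induced Γ S)
induced-mono S G⊆Γ u v e with S u | S v
... | true | true = G⊆Γ u v e

+-≤⇔ : ∀ k {a b} → k + a ≤ k + b ⇔ a ≤ b
+-≤⇔ k = mk⇔ (+-cancelˡ-≤ k _ _) (+-monoʳ-≤ k)

-- Cut the line just after p and move everything to its right by suc B; the intervals
-- [loK v, hiK v] of the vertices of M, which lie in [0, B], are placed into the gap.
module Splice {n} (M : VSet n) (lo hi loK hiK : Fin n → ℕ) (p B : ℕ) where

  shift : ℕ → ℕ
  shift t = if does (t ≤? p) then t else suc B + t

  lo′ hi′ : Fin n → ℕ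
  lo′ v = if M v then suc p + loK v else shift (lo v)
  hi′ v = if M v then suc p + hiK v else shift (hi v)

  shift-low : ∀ {t} → t ≤ p → shift t ≡ t
  shift-low {t} t≤p rewrite dec-true (t ≤? p) t≤p = refl

  shift-high : ∀ {t} → ¬ t ≤ p → shift t ≡ suc B + t
  shift-high {t} t≰p rewrite dec-false (t ≤? p) t≰p = refl

  shift-≤⇔ : ∀ s t → shift s ≤ shift t ⇔ s ≤ t
  shift-≤⇔ s t with s ≤? p | t ≤? p
  ... | yes s≤p | yes t≤p rewrite shift-low s≤p | shift-low t≤p = ⇔-refl
  ... | yes s≤p | no t≰p rewrite shift-low s≤p | shift-high t≰p =
    mk⇔ (λ _ → ≤-trans s≤p (<⇒≤ (≰⇒> t≰p))) (λ s≤t → ≤-trans s≤t (m≤n+m t (suc B)))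
  ... | no s≰p | yes t≤p rewrite shift-high s≰p | shift-low t≤p =
    mk⇔ (λ le → contradiction (≤-trans (m≤n+m s (suc B)) le) (<⇒≱ (≤-<-trans t≤p (≰⇒> s≰p))))
        (λ s≤t → contradiction (≤-trans s≤t t≤p) s≰p)
  ... | no s≰p | no t≰p rewrite shift-high s≰p | shift-high t≰p = +-≤⇔ (suc B)

  lo′≤hi′ : (∀ v → lo v ≤ hi v) → (∀ v → v ∈ M → loK v ≤ hiK v) → ∀ v → lo′ v ≤ hi′ v
  lo′≤hi′ lo≤hi loK≤hiK v with M v in v∈M
  ... | true  = +-monoʳ-≤ (suc p) (loK≤hiK v v∈M)
  ... | false = Equivalence.from (shift-≤⇔ (lo v) (hi v)) (lo≤hi v)

  meets-outside : ∀ {u v} → u ∉ M → v ∉ M → Meets lo′ hi′ u v ⇔ Meets lo hi u v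
  meets-outside {u} {v} u∉M v∉M rewrite u∉M | v∉M = shift-≤⇔ (lo u) (hi v) ×-⇔ shift-≤⇔ (lo v) (hi u)

  meets-inside : ∀ {u v} → u ∈ M → v ∈ M → Meets lo′ hi′ u v ⇔ Meets loK hiK u v
  meets-inside u∈M v∈M rewrite u∈M | v∈M = +-≤⇔ (suc p) ×-⇔ +-≤⇔ (suc p)

  meets-across : (∀ v → v ∈ M → loK v ≤ hiK v) → (∀ v → v ∈ M → hiK v ≤ B) →
    ∀ {x v} → x ∉ M → v ∈ M → Meets lo′ hi′ x v ⇔ Straddles lo hi p x
  meets-across loK≤hiK hiK≤B {x} {v} x∉M v∈M rewrite x∉M | v∈M = mk⇔ to from
    where
    to : shift (lo x) ≤ suc p + hiK v × suc p + loK v ≤ shift (hi x) → Straddles lo hi p x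
    to (a , b) = lo≤p , p<hi
      where
      lo≤p : lo x ≤ p
      lo≤p with lo x ≤? p
      ... | yes le = le
      ... | no lo≰p = contradiction (subst (_≤ suc p + hiK v) (shift-high lo≰p) a) (<⇒≱ (begin-strict
        suc p + hiK v ≤⟨ +-mono-≤ (≰⇒> lo≰p) (hiK≤B v v∈M) ⟩
        lo x + B      <⟨ n<1+n (lo x + B) ⟩
        suc (lo x + B) ≡⟨ cong suc (+-comm (lo x) B) ⟩
        suc B + lo x  ∎))
        where open ≤-Reasoning
      p<hi : suc p ≤ hi x
      p<hi with hi x ≤? p
      ... | no hi≰p = ≰⇒> hi≰p
      ... | yes hi≤p = contradiction (≤-trans (subst (suc p + loK v ≤_) (shift-low hi≤p) b) hi≤p)
                                     (<⇒≱ (m≤m+n (suc p) (loK v)))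
    from : Straddles lo hi p x → shift (lo x) ≤ suc p + hiK v × suc p + loK v ≤ shift (hi x)
    from (lo≤p , p<hi) rewrite shift-low lo≤p | shift-high (<⇒≱ p<hi) =
      ≤-trans lo≤p (≤-trans (n≤1+n p) (m≤m+n (suc p) (hiK v))) ,
      subst (suc p + loK v ≤_) (+-comm (hi x) (suc B))
            (+-mono-≤ p<hi (≤-trans (loK≤hiK v v∈M) (≤-trans (hiK≤B v v∈M) (n≤1+n B))))

by-sides : ∀ {n ℓ} (M : VSet n) (P : Fin n → Fin n → Set ℓ) → (∀ {u v} → P u v → P v u) →
  (∀ {u v} → u ∈ M → v ∈ M → P u v) → (∀ {u v} → u ∉ M → v ∉ M → P u v) →
  (∀ {u v} → u ∈ M → v ∉ M → P u v) → ∀ u v → P u v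
by-sides M P P-sym inside outside across u v with M u in eu | M v in ev
... | true  | true  = inside eu ev
... | false | false = outside eu ev
... | true  | false = across eu ev
... | false | true  = P-sym (across ev eu)

replace-inside : ∀ {n} (Γ : Graph n) (M : VSet n) (H : Graph n) {u v} → u ∈ M → v ∈ M →
  adj (replace Γ M H) u v ≡ adj H u v
replace-inside Γ M H u∈M v∈M rewrite u∈M | v∈M = refl

replace-outside : ∀ {n} (Γ : Graph n) (M : VSet n) (H : Graph n) {u v} → ¬ (u ∈ M × v ∈ M) →
  adj (replace Γ M H) u v ≡ adj Γ u v
replace-outside Γ M H {u} {v} not-inside with M u | M v
... | true  | true  = contradiction (refl , refl) not-inside
... | true  | false = refl
... | false | _     = refl

walk-end∈ : ∀ {n} {G : Graph n} {M : VSet n} {u v} → ReachIn G M u v → v ∈ M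
walk-end∈ (here u∈M) = u∈M
walk-end∈ (step _ v∈M _) = v∈M

walk-transport : ∀ {n ℓ} {G : Graph n} {M : VSet n} (P : Fin n → Set ℓ) →
  (∀ {w v} → w ∈ M → v ∈ M → adj G w v ≡ true → P w → P v) → ∀ {u v} → ReachIn G M u v → P u → P v
walk-transport P preserved (here _) Pu = Pu
walk-transport P preserved (step walk v∈M e) Pu =
  preserved (walk-end∈ walk) v∈M e (walk-transport P preserved walk Pu)

uniform⇒module : ∀ {n} (Γ : Graph n) (M : VSet n) →
  (∀ x → x ∉ M → ∀ {v w} → v ∈ M → w ∈ M → adj Γ x v ≡ true → adj Γ x w ≡ true) → IsModule Γ M
uniform⇒module Γ M uniform x x∉M with any? (λ v → (M v Bool.≟ true) ×-dec (adj Γ x v Bool.≟ true))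
... | yes (v , v∈M , e) = inj₁ (λ w w∈M → uniform x x∉M v∈M w∈M e)
... | no none = inj₂ (λ w w∈M → ¬-not (λ e → none (w , w∈M , e)))

-- The gap (p, p + 1) with α ≤ p < β closest to the point q.
nearestGap : ℕ → ℕ → ℕ → ℕ
nearestGap α β q = (q ⊔ α) ⊓ pred β

nearestGap-between : ∀ {α β} q → α < β → α ≤ nearestGap α β q × suc (nearestGap α β q) ≤ β
nearestGap-between {α} {suc β} q (s≤s α≤β) = ⊓-glb (m≤n⊔m q α) α≤β , s≤s (m⊓n≤n (q ⊔ α) β)

nearestGap-covers : ∀ {α β a b q} → α < β → a ≤ q → q ≤ b → a ≤ β → α ≤ b →
  a ≤ suc (nearestGap α β q) × nearestGap α β q ≤ b
nearestGap-covers {α} {suc β} {q = q} _ a≤q q≤b a≤β α≤b =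
  ⊓-glb (≤-trans a≤q (≤-trans (m≤m⊔n q α) (n≤1+n _))) a≤β ,
  ≤-trans (m⊓n≤m (q ⊔ α) β) (⊔-lub q≤b α≤b)

-- Minimum interval supergraphs

module MinimumIntervalSupergraph {n} (G Ĝ : Graph n) (I : IntervalModel Ĝ) (G⊆Ĝ : SubgraphOf G Ĝ)
  (minimum : ∀ Γ → IsIntervalSupergraphOn full G Γ → edgeCount Ĝ ≤ edgeCount Γ) (M : VSet n) where

  open IntervalModel I

  no-fewer-crossings : ∀ Γ → IsIntervalSupergraphOn full G Γ → (∀ u v → M u ≡ M v → adj Γ u v ≡ adj Ĝ u v) →
    ¬ crossing Γ M < crossing Ĝ M
  no-fewer-crossings Γ Γ-ok same-side fewer =
    <⇒≱ (edgeCount-<-of-crossing {G = Γ} {Ĝ} M same-side fewer) (minimum Γ Γ-ok)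

  supergraph-by-sides : ∀ Γ → (∀ u v → M u ≡ M v → adj Γ u v ≡ adj Ĝ u v) →
    (∀ {u v} → u ∈ M → v ∉ M → adj G u v ≡ true → adj Γ u v ≡ true) → SubgraphOf G Γ
  supergraph-by-sides Γ same-side across = by-sides M (λ u v → adj G u v ≡ true → adj Γ u v ≡ true)
    (λ {u} {v} edge e → trans (adj-sym Γ v u) (edge (trans (adj-sym G u v) e)))
    (λ {u} {v} u∈M v∈M e → trans (same-side u v (trans u∈M (sym v∈M))) (G⊆Ĝ u v e))
    (λ {u} {v} u∉M v∉M e → trans (same-side u v (trans u∉M (sym v∉M))) (G⊆Ĝ u v e))
    across

  module Window (u₀ w₀ : Fin n) (u₀∈M : u₀ ∈ M) (w₀∈M : w₀ ∈ M)
    (α≤hi : ∀ {v} → v ∈ M → hi u₀ ≤ hi v) (lo≤β : ∀ {v} → v ∈ M → lo v ≤ lo w₀) where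

    α β : ℕ
    α = hi u₀
    β = lo w₀

    meets-window : ∀ {x v} → lo x ≤ α → β ≤ hi x → v ∈ M → Meets lo hi x v
    meets-window lo≤α β≤hi v∈M = ≤-trans lo≤α (α≤hi v∈M) , ≤-trans (lo≤β v∈M) β≤hi

    meets-in-window : β ≤ α → ∀ {v w} → v ∈ M → w ∈ M → Meets lo hi v w
    meets-in-window β≤α v∈M = meets-window (≤-trans (lo≤β v∈M) β≤α) (≤-trans β≤α (α≤hi v∈M))

    window-clique : β ≤ α → IsClique Ĝ M
    window-clique β≤α v w v∈M w∈M v≢w = meets⇒adj v≢w (meets-in-window β≤α v∈M w∈M)

    neighbour-window : IsModule G M → ∀ {y v} → y ∉ M → v ∈ M → adj G y v ≡ true → lo y ≤ α × β ≤ hi y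
    neighbour-window modG {y} y∉M v∈M e with modG y y∉M
    ... | inj₁ all  = proj₁ (adj⇒meets (G⊆Ĝ y u₀ (all u₀ u₀∈M))) , proj₂ (adj⇒meets (G⊆Ĝ y w₀ (all w₀ w₀∈M)))
    ... | inj₂ none = contradiction (trans (sym e) (none _ v∈M)) λ ()

    module Squeezed (modG : IsModule G M) (β≤α : β ≤ α) where

      lo♭ hi♭ : Fin n → ℕ
      lo♭ v = if M v then β else lo v
      hi♭ v = if M v then α else hi v

      Γ♭ : Graph n
      Γ♭ = intervalGraph lo♭ hi♭

      I♭ : IntervalModel Γ♭
      I♭ = intervalGraph-model lo♭ hi♭ lo♭≤hi♭
        where
        lo♭≤hi♭ : ∀ v → lo♭ v ≤ hi♭ v
        lo♭≤hi♭ v with M v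
        ... | true  = β≤α
        ... | false = lo≤hi v

      same-side : ∀ u v → M u ≡ M v → adj Γ♭ u v ≡ adj Ĝ u v
      same-side u v Mu≡Mv = adj-cong-models I♭ I u v (λ u≢v → meets♭⇔meets (M u) refl (sym Mu≡Mv))
        where
        meets♭⇔meets : ∀ b → M u ≡ b → M v ≡ b → Meets lo♭ hi♭ u v ⇔ Meets lo hi u v
        meets♭⇔meets true u∈M v∈M rewrite u∈M | v∈M =
          mk⇔ (λ _ → meets-in-window β≤α u∈M v∈M) (λ _ → β≤α , β≤α)
        meets♭⇔meets false u∉M v∉M rewrite u∉M | v∉M = ⇔-refl

      adj♭⇔ : ∀ {v x} → v ∈ M → x ∉ M → adj Γ♭ v x ≡ true ⇔ (β ≤ hi x × lo x ≤ α)
      adj♭⇔ v∈M x∉M = ⇔-trans (IntervalModel.adj⇔meets I♭ (∈∉⇒≢ {S = M} v∈M x∉M)) (meets♭ v∈M x∉M)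
        where
        meets♭ : ∀ {v x} → v ∈ M → x ∉ M → Meets lo♭ hi♭ v x ⇔ (β ≤ hi x × lo x ≤ α)
        meets♭ v∈M x∉M rewrite v∈M | x∉M = ⇔-refl

      shrinks-across : ∀ {v x} → v ∈ M → x ∉ M → adj Γ♭ v x ≡ true → adj Ĝ v x ≡ true
      shrinks-across v∈M x∉M e with Equivalence.to (adj♭⇔ v∈M x∉M) e
      ... | β≤hi , lo≤α = meets⇒adj (∈∉⇒≢ {S = M} v∈M x∉M) (swap (meets-window lo≤α β≤hi v∈M))

      G⊆Γ♭ : SubgraphOf G Γ♭
      G⊆Γ♭ = supergraph-by-sides Γ♭ same-side across
        where
        across : ∀ {u v} → u ∈ M → v ∉ M → adj G u v ≡ true → adj Γ♭ u v ≡ true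
        across {u} {v} u∈M v∉M e with neighbour-window modG v∉M u∈M (trans (adj-sym G v u) e)
        ... | lo≤α , β≤hi = Equivalence.from (adj♭⇔ u∈M v∉M) (β≤hi , lo≤α)

      survives : ∀ {v x} → v ∈ M → x ∉ M → adj Ĝ v x ≡ true → adj Γ♭ v x ≡ true
      survives {v} {x} v∈M x∉M e with adj Γ♭ v x in e♭
      ... | true  = refl
      ... | false = contradiction fewer (no-fewer-crossings Γ♭ (model⇒isInterval I♭ , G⊆Γ♭) same-side)
        where
        ⊆Ĝ : ∀ {w} → w ∈ M → outNbrs Γ♭ M w ⊆ outNbrs Ĝ M w
        ⊆Ĝ {w} w∈M = outNbrs-⊆ {G = Γ♭} {Ĝ} M (λ {x} → shrinks-across {w} {x} w∈M)
        fewer : crossing Γ♭ M < crossing Ĝ M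
        fewer = crossing-< {G = Γ♭} {Ĝ} M (λ w w∈M → count-mono (⊆Ĝ w∈M)) v v∈M
          (count-strict (⊆Ĝ v∈M) x (trans (outNbrs-∉ Γ♭ M {v} x∉M) e♭) (trans (outNbrs-∉ Ĝ M {v} x∉M) e))

      uniform : ∀ x → x ∉ M → ∀ {v w} → v ∈ M → w ∈ M → adj Ĝ x v ≡ true → adj Ĝ x w ≡ true
      uniform x x∉M {v} {w} v∈M w∈M e
        with Equivalence.to (adj♭⇔ v∈M x∉M) (survives v∈M x∉M (trans (adj-sym Ĝ v x) e))
      ... | β≤hi , lo≤α = meets⇒adj (∈∉⇒≢ {S = M} w∈M x∉M ∘ sym) (meets-window lo≤α β≤hi w∈M)

    module Spread (modG : IsModule G M) (conn : ConnectedIn G M) (α<β : α < β) where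

      straddles? : ∀ p x → Dec (Straddles lo hi p x)
      straddles? p x = lo x ≤? p ×-dec suc p ≤? hi x

      Straddlers : ℕ → VSet n
      Straddlers p x = not (M x) ∧ does (straddles? p x)

      Covers : Fin n → ℕ → Set
      Covers v p = lo v ≤ suc p × p ≤ hi v

      InWindow : ℕ → Set
      InWindow p = α ≤ p × p < β

      common-gap : ∀ {v w} → v ∈ M → w ∈ M → Meets lo hi v w → ∃[ p ] InWindow p × Covers v p × Covers w p
      common-gap {v} {w} v∈M w∈M (lov≤hiw , low≤hiv) =
        p , nearestGap-between q α<β ,
        nearestGap-covers α<β (m≤m⊔n (lo v) (lo w)) (⊔-lub (lo≤hi v) low≤hiv) (lo≤β v∈M) (α≤hi v∈M) ,
        nearestGap-covers α<β (m≤n⊔m (lo v) (lo w)) (⊔-lub lov≤hiw (lo≤hi w)) (lo≤β w∈M) (α≤hi w∈M)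
        where
        q = lo v ⊔ lo w
        p = nearestGap α β q

      covered : ∀ {v} → v ∈ M → ∃[ p ] InWindow p × Covers v p
      covered {v} v∈M with common-gap v∈M v∈M (lo≤hi v , lo≤hi v)
      ... | p , window , covers , _ = p , window , covers

      Straddlers⊆outNbrs : ∀ {v p} → v ∈ M → Covers v p → Straddlers p ⊆ outNbrs Ĝ M v
      Straddlers⊆outNbrs {v} {p} v∈M (lo≤p+1 , p≤hi) x x∈S with M x in ex
      ... | false with does⇒ (straddles? p x) x∈S
      ...   | lox≤p , p<hix = meets⇒adj (∈∉⇒≢ {S = M} v∈M ex) (≤-trans lo≤p+1 p<hix , ≤-trans lox≤p p≤hi)

      module Cheapest (p* : ℕ) (p*-window : InWindow p*)
        (p*-cheapest : ∀ {p} → InWindow p → count (Straddlers p*) ≤ count (Straddlers p)) where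

        open Splice M lo hi lo hi p* (sum hi)

        Γ* : Graph n
        Γ* = intervalGraph lo′ hi′

        I* : IntervalModel Γ*
        I* = intervalGraph-model lo′ hi′ (lo′≤hi′ lo≤hi (λ v _ → lo≤hi v))

        meets*-across : ∀ {x v} → x ∉ M → v ∈ M → Meets lo′ hi′ x v ⇔ Straddles lo hi p* x
        meets*-across = meets-across (λ v _ → lo≤hi v) (λ v _ → f[i]≤∑f hi v)

        same-side : ∀ u v → M u ≡ M v → adj Γ* u v ≡ adj Ĝ u v
        same-side u v Mu≡Mv = adj-cong-models I* I u v (λ _ → meets*⇔meets (M u) refl (sym Mu≡Mv))
          where
          meets*⇔meets : ∀ b → M u ≡ b → M v ≡ b → Meets lo′ hi′ u v ⇔ Meets lo hi u v
          meets*⇔meets true  u∈M v∈M = meets-inside u∈M v∈M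
          meets*⇔meets false u∉M v∉M = meets-outside u∉M v∉M

        across* : ∀ {v x} → v ∈ M → x ∉ M → adj Γ* v x ≡ does (straddles? p* x)
        across* {v} {x} v∈M x∉M =
          ⇔→≡ (⇔-trans adj⇔straddles (mk⇔ (dec-true (straddles? p* x)) (does⇒ (straddles? p* x))))
          where
          adj⇔straddles : adj Γ* v x ≡ true ⇔ Straddles lo hi p* x
          adj⇔straddles = ⇔-trans (IntervalModel.adj⇔meets I* (∈∉⇒≢ {S = M} v∈M x∉M))
                                  (⇔-trans (mk⇔ swap swap) (meets*-across x∉M v∈M))

        G⊆Γ* : SubgraphOf G Γ*
        G⊆Γ* = supergraph-by-sides Γ* same-side across
          where
          across : ∀ {u v} → u ∈ M → v ∉ M → adj G u v ≡ true → adj Γ* u v ≡ true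
          across {u} {v} u∈M v∉M e with neighbour-window modG v∉M u∈M (trans (adj-sym G v u) e)
          ... | lo≤α , β≤hi = trans (across* u∈M v∉M)
            (dec-true (straddles? p* v) (≤-trans lo≤α (proj₁ p*-window) , ≤-trans (proj₂ p*-window) β≤hi))

        row* : ∀ {w} → w ∈ M → count (outNbrs Γ* M w) ≡ count (Straddlers p*)
        row* {w} w∈M = count-cong row-entry
          where
          row-entry : ∀ x → outNbrs Γ* M w x ≡ Straddlers p* x
          row-entry x = by-side (M x) refl
            where
            by-side : ∀ b → M x ≡ b → not b ∧ adj Γ* w x ≡ not b ∧ does (straddles? p* x)
            by-side true  _   = refl
            by-side false x∉M = across* w∈M x∉M

        outdeg≤ : ∀ {v} → v ∈ M → count (outNbrs Ĝ M v) ≤ count (Straddlers p*)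
        outdeg≤ {v} v∈M = ≮⇒≥ λ more →
          no-fewer-crossings Γ* (model⇒isInterval I* , G⊆Γ*) same-side
            (crossing-< {G = Γ*} {Ĝ} M rows v v∈M (subst (_< count (outNbrs Ĝ M v)) (sym (row* v∈M)) more))
          where
          rows : ∀ w → w ∈ M → count (outNbrs Γ* M w) ≤ count (outNbrs Ĝ M w)
          rows w w∈M with covered w∈M
          ... | p , window , covers = begin
            count (outNbrs Γ* M w)  ≡⟨ row* w∈M ⟩
            count (Straddlers p*)   ≤⟨ p*-cheapest window ⟩
            count (Straddlers p)    ≤⟨ count-mono (Straddlers⊆outNbrs w∈M covers) ⟩
            count (outNbrs Ĝ M w)   ∎
            where open ≤-Reasoning

        outNbrs⊆Straddlers : ∀ {v p} → v ∈ M → InWindow p → Covers v p → outNbrs Ĝ M v ⊆ Straddlers p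
        outNbrs⊆Straddlers v∈M window covers =
          ⊆∧count≥⇒⊇ (Straddlers⊆outNbrs v∈M covers) (≤-trans (outdeg≤ v∈M) (p*-cheapest window))

        neighbours-agree : ∀ {v w} → v ∈ M → w ∈ M → adj G v w ≡ true → outNbrs Ĝ M v ⊆ outNbrs Ĝ M w
        neighbours-agree v∈M w∈M e with common-gap v∈M w∈M (adj⇒meets (G⊆Ĝ _ _ e))
        ... | p , window , covers-v , covers-w =
          λ x → Straddlers⊆outNbrs w∈M covers-w x ∘ outNbrs⊆Straddlers v∈M window covers-v x

        uniform : ∀ x → x ∉ M → ∀ {v w} → v ∈ M → w ∈ M → adj Ĝ x v ≡ true → adj Ĝ x w ≡ true
        uniform x x∉M {v} {w} v∈M w∈M e =
          trans (adj-sym Ĝ x w) (trans (sym (outNbrs-∉ Ĝ M {w} x∉M))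
            (walk-transport (λ u → outNbrs Ĝ M u x ≡ true) (λ w∈M u∈M e′ → neighbours-agree w∈M u∈M e′ x)
              (conn v w v∈M w∈M) (trans (outNbrs-∉ Ĝ M {v} x∉M) (trans (adj-sym Ĝ v x) e))))

      uniform : ∀ x → x ∉ M → ∀ {v w} → v ∈ M → w ∈ M → adj Ĝ x v ≡ true → adj Ĝ x w ≡ true
      uniform with minimiser-between (λ p → count (Straddlers p)) α<β
      ... | p* , p*-window , p*-cheapest = Cheapest.uniform p* p*-window p*-cheapest

    module Replacement (modĜ : IsModule Ĝ M) (α<β : α < β) (H : Graph n) (H-on : OnVertexSet M H)
      (loK hiK : Fin n → ℕ) (loK≤hiK : ∀ v → v ∈ M → loK v ≤ hiK v)
      (H-adj⇔ : ∀ u v → u ∈ M → v ∈ M → u ≢ v → adj H u v ≡ true ⇔ Meets loK hiK u v)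
      (G[M]⊆H : SubgraphOf (induced G M) H)
      (H-minimum : ∀ H′ → IsIntervalSupergraphOn M (induced G M) H′ → edgeCount H ≤ edgeCount H′) where

      adj⇔straddles : ∀ {x v} → x ∉ M → v ∈ M → adj Ĝ x v ≡ true ⇔ Straddles lo hi α x
      adj⇔straddles {x} {v} x∉M v∈M = mk⇔ to from
        where
        to : adj Ĝ x v ≡ true → Straddles lo hi α x
        to e with modĜ x x∉M
        ... | inj₁ all  = proj₁ (adj⇒meets (all u₀ u₀∈M)) , ≤-trans α<β (proj₂ (adj⇒meets (all w₀ w₀∈M)))
        ... | inj₂ none = contradiction (trans (sym e) (none v v∈M)) λ ()
        from : Straddles lo hi α x → adj Ĝ x v ≡ true
        from (lo≤α , α<hi) with modĜ x x∉M
        ... | inj₁ all  = all v v∈M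
        ... | inj₂ none = contradiction (trans (sym x~u₀) (none u₀ u₀∈M)) λ ()
          where
          x~u₀ : adj Ĝ x u₀ ≡ true
          x~u₀ = meets⇒adj (∈∉⇒≢ {S = M} u₀∈M x∉M ∘ sym) (lo≤α , ≤-trans (lo≤hi u₀) (<⇒≤ α<hi))

      open Splice M lo hi loK hiK α (sum hiK)

      R : Graph n
      R = replace Ĝ M H

      R-model : IntervalModel R
      R-model = record
        { lo = lo′ ; hi = hi′ ; lo≤hi = lo′≤hi′ lo≤hi loK≤hiK
        ; adj⇔meets = λ {u} {v} → by-sides M P P-sym inside outside across u v }
        where
        P : Fin n → Fin n → Set
        P u v = u ≢ v → adj R u v ≡ true ⇔ Meets lo′ hi′ u v
        P-sym : ∀ {u v} → P u v → P v u
        P-sym {u} {v} p v≢u = ⇔-trans (≡-true⇔ (adj-sym R v u)) (⇔-trans (p (v≢u ∘ sym)) (mk⇔ swap swap))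
        inside : ∀ {u v} → u ∈ M → v ∈ M → P u v
        inside {u} {v} u∈M v∈M u≢v = ⇔-trans (≡-true⇔ (replace-inside Ĝ M H u∈M v∈M))
          (⇔-trans (H-adj⇔ u v u∈M v∈M u≢v) (⇔-sym (meets-inside u∈M v∈M)))
        outside : ∀ {u v} → u ∉ M → v ∉ M → P u v
        outside u∉M v∉M u≢v = ⇔-trans (≡-true⇔ (replace-outside Ĝ M H (λ (u∈M , _) → ∉⇒¬∈ {S = M} u∉M u∈M)))
          (⇔-trans (adj⇔meets u≢v) (⇔-sym (meets-outside u∉M v∉M)))
        across : ∀ {u v} → u ∈ M → v ∉ M → P u v
        across {u} {v} u∈M v∉M u≢v =
          ⇔-trans (≡-true⇔ (trans (replace-outside Ĝ M H (λ (_ , v∈M) → ∉⇒¬∈ {S = M} v∉M v∈M))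
                                  (adj-sym Ĝ u v)))
            (⇔-trans (adj⇔straddles v∉M u∈M)
              (⇔-trans (⇔-sym (meets-across loK≤hiK (λ w _ → f[i]≤∑f hiK w) v∉M u∈M)) (mk⇔ swap swap)))

      G⊆R : SubgraphOf G R
      G⊆R = by-sides M (λ u v → adj G u v ≡ true → adj R u v ≡ true)
        (λ {u} {v} edge e → trans (adj-sym R v u) (edge (trans (adj-sym G u v) e)))
        (λ {u} {v} u∈M v∈M e → trans (replace-inside Ĝ M H u∈M v∈M) (G[M]⊆H u v (induced-edge u∈M v∈M e)))
        (λ {u} {v} u∉M v∉M e → trans (replace-outside Ĝ M H (λ (u∈M , _) → ∉⇒¬∈ {S = M} u∉M u∈M)) (G⊆Ĝ u v e))
        (λ {u} {v} u∈M v∉M e → trans (replace-outside Ĝ M H (λ (_ , v∈M) → ∉⇒¬∈ {S = M} v∉M v∈M)) (G⊆Ĝ u v e))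
        where
        induced-edge : ∀ {u v} → u ∈ M → v ∈ M → adj G u v ≡ true → adj (induced G M) u v ≡ true
        induced-edge u∈M v∈M e rewrite u∈M | v∈M = e

      H-absent : ∀ u v → ¬ (u ∈ M × v ∈ M) → adj H u v ≡ false
      H-absent u v not-inside with adj H u v in e
      ... | false = refl
      ... | true  = contradiction (H-on u v e , H-on v u (trans (adj-sym H v u) e)) not-inside

      H≗R[M] : ∀ u v → adj H u v ≡ adj (induced R M) u v
      H≗R[M] u v with M u in eu | M v in ev
      ... | true  | true  = refl
      ... | true  | false = H-absent u v (λ (_ , v∈M) → ∉⇒¬∈ {S = M} ev v∈M)
      ... | false | _     = H-absent u v (λ (u∈M , _) → ∉⇒¬∈ {S = M} eu u∈M)

      R≤Ĝ : edgeCount R ≤ edgeCount Ĝ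
      R≤Ĝ = edgeCount-≤-of-inside {G = R} {Ĝ} M (λ u v not-inside → replace-outside Ĝ M H not-inside)
        (subst (_≤ edgeCount (induced Ĝ M)) (edgeCount-cong {G = H} {induced R M} H≗R[M])
          (H-minimum (induced Ĝ M) (induced-interval I M , induced-mono {G = G} {Ĝ} M G⊆Ĝ)))

      R-minimum : IsMinIntervalSupergraphOn full G R
      R-minimum = (model⇒isInterval R-model , G⊆R) , λ Γ Γ-ok → ≤-trans R≤Ĝ (minimum Γ Γ-ok)

  module-of-minimum : IsModule G M → ConnectedIn G M → IsModule Ĝ M
  module-of-minimum modG conn = uniform⇒module Ĝ M uniform
    where
    uniform : ∀ x → x ∉ M → ∀ {v w} → v ∈ M → w ∈ M → adj Ĝ x v ≡ true → adj Ĝ x w ≡ true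
    uniform x x∉M v∈M with minimiser hi M v∈M | maximiser lo M v∈M
    ... | u₀ , u₀∈M , α≤hi | w₀ , w₀∈M , lo≤β with lo w₀ ≤? hi u₀
    ...   | yes β≤α = Window.Squeezed.uniform u₀ w₀ u₀∈M w₀∈M α≤hi lo≤β modG β≤α x x∉M v∈M
    ...   | no  β≰α = Window.Spread.uniform u₀ w₀ u₀∈M w₀∈M α≤hi lo≤β modG conn (≰⇒> β≰α) x x∉M v∈M

  replacement : IsModule Ĝ M → ¬ IsClique Ĝ M → ∀ H → IsMinIntervalSupergraphOn M (induced G M) H →
    IsMinIntervalSupergraphOn full G (replace Ĝ M H)
  replacement modĜ ¬clique H (((H-on , loK , hiK , loK≤hiK , H-adj⇔) , G[M]⊆H) , H-minimum)
    with any? (λ v → M v Bool.≟ true)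
  ... | no M-empty = contradiction (λ v _ v∈M _ _ → contradiction (v , v∈M) M-empty) ¬clique
  ... | yes (u , u∈M) with minimiser hi M u∈M | maximiser lo M u∈M
  ... | u₀ , u₀∈M , α≤hi | w₀ , w₀∈M , lo≤β with lo w₀ ≤? hi u₀
  ...   | yes β≤α = contradiction (Window.window-clique u₀ w₀ u₀∈M w₀∈M α≤hi lo≤β β≤α) ¬clique
  ...   | no  β≰α = Window.Replacement.R-minimum u₀ w₀ u₀∈M w₀∈M α≤hi lo≤β modĜ (≰⇒> β≰α)
                      H H-on loK hiK loK≤hiK H-adj⇔ G[M]⊆H H-minimum

theorem3p4 : ∀ {n : ℕ} (G Ĝ : Graph n) →
    IsMinIntervalSupergraphOn full G Ĝ →
    (M : VSet n) → IsModule G M → ConnectedIn G M →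
    IsModule Ĝ M ×
    (¬ IsClique Ĝ M →
      ∀ (H : Graph n) → IsMinIntervalSupergraphOn M (induced G M) H →
        IsMinIntervalSupergraphOn full G (replace Ĝ M H))
theorem3p4 G Ĝ ((Ĝ-interval , G⊆Ĝ) , minimum) M modG conn = Ĝ-module , replacement Ĝ-module
  where
  open MinimumIntervalSupergraph G Ĝ (isInterval⇒model Ĝ-interval) G⊆Ĝ minimum M
  Ĝ-module : IsModule Ĝ M
  Ĝ-module = module-of-minimum modG conn
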